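{- Let $\Gamma\cup\{\alpha,\beta,\varphi\}\subseteq Fm$. If $\Gamma,\square\alpha\rightarrow\square\beta\vdash\varphi$ and $\Gamma,\square\beta\rightarrow\square\alpha\vdash\varphi$, then $\Gamma\vdash\varphi$, where $\vdash$ denotes derivability in $\mathrm{S5}(\mathcal L)_\infty$.
   Context: Let $Fm$ be the set of formulas over a countably infinite set of variables with $\wedge,\vee,*,\rightarrow,\bar0$ and unary $\square,\lozenge$; $\alpha\equiv\beta:=(\alpha\rightarrow\beta)\wedge(\beta\rightarrow\alpha)$, $\psi^n$ the $n$-fold $*$-power. $\mathrm{S5}(\mathcal L)$ is the calculus with the following axioms: - all instances of the axiom schemata of Łukasiewicz propositional logic; - $\square\varphi\rightarrow\varphi$; - $\varphi\rightarrow\lozenge\varphi$; - $\square(\nu\rightarrow\varphi)\rightarrow(\nu\rightarrow\square\varphi)$; - $\square(\varphi\rightarrow\nu)\rightarrow(\lozenge\varphi\rightarrow\nu)$; - $\square(\varphi\vee\nu)\rightarrow(\square\varphi\vee\nu)$; - $\lozenge(\varphi*\varphi)\equiv(\lozenge\varphi)*(\lozenge\varphi)$. Here $\nu$ is any propositional combination of formulas beginning with $\square$ or $\lozenge$. Its rules are Modus Ponens and Necessitation (from $\varphi$ infer $\square\varphi$). $\mathrm{S5}(\mathcal L)_\infty$ adds the rule $\square$Inf: from $\square\varphi\vee(\square\alpha\rightarrow(\square\beta)^n)$ for every $n\in\mathbb N$, infer $\square\varphi\vee(\square\alpha\rightarrow\square\alpha*\square\beta)$. $\Gamma\vdash\varphi$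 means there is a (possibly transfinite) well-ordered derivation of $\varphi$ in which each member is an axiom instance, a member of $\Gamma$, or the conclusion of a rule instance whose premises occur earlier. -}

module Defs where

open import Data.Nat using (ℕ; zero; suc)
open import Data.Sum using (_⊎_)
open import Relation.Binary.PropositionalEquality using (_≡_)

infixr 6 _⇒_
infixl 8 _∧_ _∨_
infixl 9 _⊛_
infix 5 _⇔_
infix 10 □_ ◇_ ¬′_

data Fm : Set where
  var  : ℕ → Fm
  _∧_  : Fm → Fm → Fm
  _∨_  : Fm → Fm → Fm
  _⊛_  : Fm → Fm → Fm
  _⇒_  : Fm → Fm → Fm
  𝟘    : Fm
  □_   : Fm → Fm
  ◇_   : Fm → Fm

_⇔_ : Fm → Fm → Fm
a ⇔ b = (a ⇒ b) ∧ (b ⇒ a)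

¬′_ : Fm → Fm
¬′ a = a ⇒ 𝟘

-- pow n ψ is the (n+1)-fold *-power ψ^(n+1); pow 0 ψ = ψ.
pow : ℕ → Fm → Fm
pow zero    ψ = ψ
pow (suc n) ψ = pow n ψ ⊛ ψ

data Modal : Fm → Set where
  m□  : ∀ a → Modal (□ a)
  m◇  : ∀ a → Modal (◇ a)
  m𝟘  : Modal 𝟘
  m∧  : ∀ {a b} → Modal a → Modal b → Modal (a ∧ b)
  m∨  : ∀ {a b} → Modal a → Modal b → Modal (a ∨ b)
  m⊛  : ∀ {a b} → Modal a → Modal b → Modal (a ⊛ b)
  m⇒  : ∀ {a b} → Modal a → Modal b → Modal (a ⇒ b)

-- Axioms of Łukasiewicz logic: MTL axioms (Esteva–Godo) in the language
-- with primitive ∧, ∨, plus divisibility (giving BL) and double negation.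
data ŁAx : Fm → Set where
  a1  : ∀ φ ψ χ → ŁAx ((φ ⇒ ψ) ⇒ ((ψ ⇒ χ) ⇒ (φ ⇒ χ)))
  a2  : ∀ φ ψ → ŁAx (φ ⊛ ψ ⇒ φ)
  a3  : ∀ φ ψ → ŁAx (φ ⊛ ψ ⇒ ψ ⊛ φ)
  a4  : ∀ φ ψ → ŁAx (φ ∧ ψ ⇒ φ)
  a5  : ∀ φ ψ → ŁAx (φ ∧ ψ ⇒ ψ ∧ φ)
  a6  : ∀ φ ψ → ŁAx (φ ⊛ (φ ⇒ ψ) ⇒ φ ∧ ψ)
  a7a : ∀ φ ψ χ → ŁAx ((φ ⇒ (ψ ⇒ χ)) ⇒ (φ ⊛ ψ ⇒ χ))
  a7b : ∀ φ ψ χ → ŁAx ((φ ⊛ ψ ⇒ χ) ⇒ (φ ⇒ (ψ ⇒ χ)))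
  a8  : ∀ φ ψ χ → ŁAx (((φ ⇒ ψ) ⇒ χ) ⇒ (((ψ ⇒ φ) ⇒ χ) ⇒ χ))
  a9  : ∀ φ → ŁAx (𝟘 ⇒ φ)
  ∨i₁ : ∀ φ ψ → ŁAx (φ ⇒ φ ∨ ψ)
  ∨i₂ : ∀ φ ψ → ŁAx (ψ ⇒ φ ∨ ψ)
  ∨e  : ∀ φ ψ χ → ŁAx ((φ ⇒ χ) ⇒ ((ψ ⇒ χ) ⇒ (φ ∨ ψ ⇒ χ)))
  div : ∀ φ ψ → ŁAx (φ ∧ ψ ⇒ φ ⊛ (φ ⇒ ψ))
  dn  : ∀ φ → ŁAx (¬′ ¬′ φ ⇒ φ)

data Ax : Fm → Set where
  ł    : ∀ {φ} → ŁAx φ → Ax φ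
  T□   : ∀ φ → Ax (□ φ ⇒ φ)
  T◇   : ∀ φ → Ax (φ ⇒ ◇ φ)
  K□   : ∀ ν φ → Modal ν → Ax (□ (ν ⇒ φ) ⇒ (ν ⇒ □ φ))
  K◇   : ∀ ν φ → Modal ν → Ax (□ (φ ⇒ ν) ⇒ (◇ φ ⇒ ν))
  □∨   : ∀ ν φ → Modal ν → Ax (□ (φ ∨ ν) ⇒ (□ φ ∨ ν))
  ◇⊛   : ∀ φ → Ax (◇ (φ ⊛ φ) ⇔ (◇ φ ⊛ ◇ φ))

_,,_ : (Fm → Set) → Fm → (Fm → Set)
(Γ ,, χ) ψ = Γ ψ ⊎ ψ ≡ χ

-- Derivability in S5(Ł)∞ (well-founded, possibly infinitely branching
-- derivation trees = well-ordered transfinite derivations).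
infix 4 _⊢_
data _⊢_ (Γ : Fm → Set) : Fm → Set where
  ax   : ∀ {φ} → Ax φ → Γ ⊢ φ
  hyp  : ∀ {φ} → Γ φ → Γ ⊢ φ
  mp   : ∀ {φ ψ} → Γ ⊢ φ → Γ ⊢ (φ ⇒ ψ) → Γ ⊢ ψ
  nec  : ∀ {φ} → Γ ⊢ φ → Γ ⊢ □ φ
  □inf : ∀ φ α β →
         ((n : ℕ) → Γ ⊢ (□ φ ∨ (□ α ⇒ pow n (□ β)))) →
         Γ ⊢ (□ φ ∨ (□ α ⇒ □ α ⊛ □ β))

{-# OPTIONS --safe #-}
module Submission where

-- Prelinearity gives Γ ⊢ ν ∨ χ for ν = □β → □α and χ = □α → □β.  Since ν is
-- modal, the axiom □(ψ ∨ ν) → □ψ ∨ ν lets a disjunct ν ride along every step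
-- of a derivation from Γ, χ, Necessitation and □Inf included; so Γ ⊢ ν ∨ φ,
-- hence Γ ⊢ □φ ∨ ν.  Now □φ is modal, and running the derivation from Γ, ν
-- under the disjunct □φ gives Γ ⊢ □φ ∨ φ, which yields φ by □φ → φ.

open import Defs
open import Data.Sum using (inj₁; inj₂)
open import Relation.Binary.PropositionalEquality using (refl)

module Derived (Γ : Fm → Set) where

  ł-axiom : ∀ {φ} → ŁAx φ → Γ ⊢ φ
  ł-axiom x = ax (ł x)

  ⇒-trans : ∀ {p q r} → Γ ⊢ p ⇒ q → Γ ⊢ q ⇒ r → Γ ⊢ p ⇒ r
  ⇒-trans p⇒q q⇒r = mp q⇒r (mp p⇒q (ł-axiom (a1 _ _ _)))

  curry : ∀ {p q r} → Γ ⊢ p ⊛ q ⇒ r → Γ ⊢ p ⇒ (q ⇒ r)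
  curry h = mp h (ł-axiom (a7b _ _ _))

  uncurry : ∀ {p q r} → Γ ⊢ p ⇒ (q ⇒ r) → Γ ⊢ p ⊛ q ⇒ r
  uncurry h = mp h (ł-axiom (a7a _ _ _))

  ⇒-flip : ∀ {p q r} → Γ ⊢ p ⇒ (q ⇒ r) → Γ ⊢ q ⇒ (p ⇒ r)
  ⇒-flip h = curry (⇒-trans (ł-axiom (a3 _ _)) (uncurry h))

  ⇒-const : ∀ {p q} → Γ ⊢ p ⇒ (q ⇒ p)
  ⇒-const = curry (ł-axiom (a2 _ _))

  ⇒-refl : ∀ {p} → Γ ⊢ p ⇒ p
  ⇒-refl = ⇒-trans (⇒-const {q = 𝟘 ⇒ 𝟘}) (mp (ł-axiom (a9 𝟘)) ⇒-apply)
    where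
    ⇒-apply : ∀ {q r} → Γ ⊢ q ⇒ ((q ⇒ r) ⇒ r)
    ⇒-apply = curry (⇒-trans (ł-axiom (a6 _ _))
                              (⇒-trans (ł-axiom (a5 _ _)) (ł-axiom (a4 _ _))))

  ∨-injˡ : ∀ {p q} → Γ ⊢ p ⇒ p ∨ q
  ∨-injˡ = ł-axiom (∨i₁ _ _)

  ∨-injʳ : ∀ {p q} → Γ ⊢ q ⇒ p ∨ q
  ∨-injʳ = ł-axiom (∨i₂ _ _)

  [_,_] : ∀ {p q r} → Γ ⊢ p ⇒ r → Γ ⊢ q ⇒ r → Γ ⊢ p ∨ q ⇒ r
  [ p⇒r , q⇒r ] = mp q⇒r (mp p⇒r (ł-axiom (∨e _ _ _)))

  ∨-swap : ∀ {p q} → Γ ⊢ p ∨ q → Γ ⊢ q ∨ p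
  ∨-swap h = mp h [ ∨-injʳ , ∨-injˡ ]

  ∨-mapˡ : ∀ {p p′ q} → Γ ⊢ p ⇒ p′ → Γ ⊢ p ∨ q ⇒ p′ ∨ q
  ∨-mapˡ h = [ ⇒-trans h ∨-injˡ , ∨-injʳ ]

  mp-under-∨ : ∀ {m p q} → Γ ⊢ m ∨ p → Γ ⊢ m ∨ (p ⇒ q) → Γ ⊢ m ∨ q
  mp-under-∨ {m} {p} {q} m∨p m∨p⇒q = mp m∨p (mp m∨p⇒q distrib)
    where
    distrib : Γ ⊢ m ∨ (p ⇒ q) ⇒ ((m ∨ p) ⇒ (m ∨ q))
    distrib = [ curry (⇒-trans (ł-axiom (a2 _ _)) ∨-injˡ)
              , ⇒-trans (mp ∨-injʳ (⇒-flip (ł-axiom (a1 p q (m ∨ q)))))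
                        (mp ∨-injˡ (ł-axiom (∨e _ _ _))) ]

  prelinearity : ∀ p q → Γ ⊢ (p ⇒ q) ∨ (q ⇒ p)
  prelinearity p q = mp ∨-injʳ (mp ∨-injˡ (ł-axiom (a8 p q _)))

  □-mono : ∀ {p q} → Γ ⊢ p ⇒ q → Γ ⊢ □ p ⇒ □ q
  □-mono {p} {q} h = mp (nec (⇒-trans (ax (T□ p)) h)) (ax (K□ (□ p) q (m□ p)))

  Modal⇒□ : ∀ {ν} → Modal ν → Γ ⊢ ν ⇒ □ ν
  Modal⇒□ {ν} mν = mp (nec ⇒-refl) (ax (K□ ν ν mν))

  □-intro-∨ : ∀ {ν ψ} → Modal ν → Γ ⊢ ψ ∨ ν → Γ ⊢ □ ψ ∨ ν
  □-intro-∨ {ν} {ψ} mν h = mp (nec h) (ax (□∨ ν ψ mν))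

  □∨-merge : ∀ {ν φ r} → Modal ν → Γ ⊢ ν ∨ (□ φ ∨ r) ⇒ □ (φ ∨ ν) ∨ r
  □∨-merge mν = [ ⇒-trans (⇒-trans (Modal⇒□ mν) (□-mono ∨-injʳ)) ∨-injˡ
                , ∨-mapˡ (□-mono ∨-injˡ) ]

  □∨-split : ∀ {ν φ r} → Modal ν → Γ ⊢ □ (φ ∨ ν) ∨ r ⇒ ν ∨ (□ φ ∨ r)
  □∨-split {ν} {φ} mν =
    [ ⇒-trans (ax (□∨ ν φ mν)) [ ⇒-trans ∨-injˡ ∨-injʳ , ∨-injˡ ]
    , ⇒-trans ∨-injʳ ∨-injʳ ]

  modal-∨-cut : ∀ {ν χ ψ} → Modal ν → Γ ⊢ ν ∨ χ → (Γ ,, χ) ⊢ ψ → Γ ⊢ ν ∨ ψ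
  modal-∨-cut mν ν∨χ (ax a)           = mp (ax a) ∨-injʳ
  modal-∨-cut mν ν∨χ (hyp (inj₁ γ))   = mp (hyp γ) ∨-injʳ
  modal-∨-cut mν ν∨χ (hyp (inj₂ refl)) = ν∨χ
  modal-∨-cut mν ν∨χ (mp d e)         =
    mp-under-∨ (modal-∨-cut mν ν∨χ d) (modal-∨-cut mν ν∨χ e)
  modal-∨-cut mν ν∨χ (nec d)          =
    ∨-swap (□-intro-∨ mν (∨-swap (modal-∨-cut mν ν∨χ d)))
  -- The disjunct ν is moved inside the box, so that □Inf applies to φ ∨ ν.
  modal-∨-cut mν ν∨χ (□inf φ α β premises) =
    mp (□inf _ α β λ n → mp (modal-∨-cut mν ν∨χ (premises n)) (□∨-merge mν))
       (□∨-split mν)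

  modal-cases : ∀ {ν χ φ} → Modal ν → Γ ⊢ ν ∨ χ →
                (Γ ,, ν) ⊢ φ → (Γ ,, χ) ⊢ φ → Γ ⊢ φ
  modal-cases {ν} {φ = φ} mν ν∨χ from-ν from-χ =
    mp (modal-∨-cut (m□ φ) □φ∨ν from-ν) [ ax (T□ φ) , ⇒-refl ]
    where
    □φ∨ν : Γ ⊢ □ φ ∨ ν
    □φ∨ν = □-intro-∨ mν (∨-swap (modal-∨-cut mν ν∨χ from-χ))

mainTheorem19 : (Γ : Fm → Set) (α β φ : Fm) →
    (Γ ,, (□ α ⇒ □ β)) ⊢ φ → (Γ ,, (□ β ⇒ □ α)) ⊢ φ → Γ ⊢ φ
mainTheorem19 Γ α β φ from-α⇒β from-β⇒α =
  modal-cases (m⇒ (m□ β) (m□ α)) (prelinearity (□ β) (□ α)) from-β⇒α from-α⇒β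
  where open Derived Γ
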